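{- For every constant $k\ge 2$ there is a constant $c$ such that the following holds. Assume $f\colon\{0,1\}^n\to\{0,1\}$, $f\in Q_k$, and $C\le f$ is a circuit consisting only of $\mathrm{THR}^{k+1}_2$ gates and variables. Then there is a protocol $\pi$ computing the $Q_k$-communication game for $f$ with $\mathrm{depth}(\pi)\le c\cdot\mathrm{depth}(C)$.
   Context: $Q_k$ is the set of $f$ such that any $x^1,\dots,x^k\in f^{ -1}(0)$ have a coordinate $i$ with $x^1_i=\dots=x^k_i=0$. $\mathrm{THR}^{k+1}_2$ outputs $1$ iff at least $2$ of its $k+1$ inputs are $1$. A circuit consisting only of $\mathrm{THR}^{k+1}_2$ gates and variables is a DAG with an output node, internal nodes $\mathrm{THR}^{k+1}_2$ gates with $k+1$ ordered inputs, input nodes labeled by variables (no constants, no negations); depth = longest output-to-input path. $C\le f$ means $C(x)=0$ for all $x\in f^{ -1}(0)$. The $Q_k$-communication game for $f$: party $j\in[k]$ gets $x^j\in f^{ -1}(0)$, and they must output $i\in[n]$ with $x^1_i=\dots=x^k_i=0$. A protocol is a deterministic $k$-party number-in-hand protocol in which at each node one party broadcasts one bit depending on its input; its depth is the maximal number of bits communicated; it computes the game if it always outputs a correct answer. -}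

module Defs where

open import Data.Nat using (ℕ; zero; suc; _≤_; _≤ᵇ_; _⊔_; _+_)
open import Data.Fin using (Fin; zero; suc)
open import Data.Bool using (Bool; true; false; if_then_else_)
open import Data.Product using (∃; _×_)
open import Relation.Binary.PropositionalEquality using (_≡_)

-- Boolean inputs {0,1}^n, with false = 0 and true = 1.
Input : ℕ → Set
Input n = Fin n → Bool

countTrue : ∀ {m} → (Fin m → Bool) → ℕ
countTrue {zero} b = 0
countTrue {suc m} b = (if b zero then 1 else 0) + countTrue (λ i → b (suc i))

maxFin : ∀ {m} → (Fin m → ℕ) → ℕ
maxFin {zero} d = 0
maxFin {suc m} d = d zero ⊔ maxFin (λ i → d (suc i))

THR2 : (k : ℕ) → (Fin (suc k) → Bool) → Bool
THR2 k b = 2 ≤ᵇ countTrue b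

-- The nodes are listed in a topological order; a node added to a
-- circuit that already has m nodes may only use those m nodes as
-- inputs (so the graph is acyclic).  Node indices: in a list of
-- (suc m) nodes, index zero is the most recently added node and
-- (suc j) refers to index j of the earlier nodes.

data Node (k n m : ℕ) : Set where
  var : Fin n → Node k n m
  thr : (Fin (suc k) → Fin m) → Node k n m

data Nodes (k n : ℕ) : ℕ → Set where
  []  : Nodes k n zero
  _▹_ : ∀ {m} → Nodes k n m → Node k n m → Nodes k n (suc m)

record Circuit (k n : ℕ) : Set where
  constructor circuit
  field
    size   : ℕ
    nodes  : Nodes k n size
    output : Fin size

nodeVal : ∀ {k n m} → Nodes k n m → Input n → Fin m → Bool
nodeVal (ns ▹ var i) x zero = x i
nodeVal {k} (ns ▹ thr ch) x zero = THR2 k (λ l → nodeVal ns x (ch l))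
nodeVal (ns ▹ _) x (suc j) = nodeVal ns x j

nodeDepth : ∀ {k n m} → Nodes k n m → Fin m → ℕ
nodeDepth (ns ▹ var i) zero = 0
nodeDepth (ns ▹ thr ch) zero = suc (maxFin (λ l → nodeDepth ns (ch l)))
nodeDepth (ns ▹ _) (suc j) = nodeDepth ns j

eval : ∀ {k n} → Circuit k n → Input n → Bool
eval (circuit _ ns o) x = nodeVal ns x o

depthC : ∀ {k n} → Circuit k n → ℕ
depthC (circuit _ ns o) = nodeDepth ns o

_≤C_ : ∀ {k n} → Circuit k n → (Input n → Bool) → Set
C ≤C f = ∀ x → f x ≡ false → eval C x ≡ false

InQ : (k : ℕ) → ∀ {n} → (Input n → Bool) → Set
InQ k {n} f = (xs : Fin k → Input n) → (∀ j → f (xs j) ≡ false) →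
              ∃ λ (i : Fin n) → ∀ j → xs j i ≡ false

-- Deterministic k-party number-in-hand protocols (protocol trees):
-- at each internal node a party p broadcasts one bit depending only
-- on its own input; leaves are labelled by the output.

data Protocol (k n : ℕ) : Set where
  leaf : Fin n → Protocol k n
  node : (p : Fin k) → (Input n → Bool) → (ifFalse ifTrue : Protocol k n) → Protocol k n

run : ∀ {k n} → Protocol k n → (Fin k → Input n) → Fin n
run (leaf i) xs = i
run (node p b π₀ π₁) xs = if b (xs p) then run π₁ xs else run π₀ xs

depthP : ∀ {k n} → Protocol k n → ℕ
depthP (leaf _) = 0
depthP (node _ _ π₀ π₁) = suc (depthP π₀ ⊔ depthP π₁)

ComputesGame : ∀ {k n} → Protocol k n → (Input n → Bool) → Set
ComputesGame {k} {n} π f = (xs : Fin k → Input n) → (∀ j → f (xs j) ≡ false) →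
                           ∀ j → xs j (run π xs) ≡ false

module Submission where

-- The parties walk down the circuit from the output gate,
-- maintaining the invariant that the current node evaluates to 0 on every
-- party's input.  At a THR^{k+1}_2 gate each party broadcasts the values of
-- all k+1 children on its own input (k(k+1) bits in total).  Since the gate
-- is 0 on each input, every party sees at most one child equal to 1; with
-- k parties and k+1 children the pigeonhole principle yields a child that is
-- 0 for all parties, and the walk continues there.  At an input node x_i
-- the invariant says x^1_i = ... = x^k_i = 0, so i is a correct answer.
-- C ≤ f makes the invariant hold at the output node, and each gate on the
-- path costs k(k+1) bits, so c = k(k+1) works.

open import Defs
open import Data.Nat using (ℕ; _≤_; _*_)
open import Data.Nat using (zero; suc; _+_; _<_; z≤n; s≤s)
open import Data.Bool using (Bool)
open import Data.Product using (∃; _×_)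

open import Data.Nat.Properties
  using (≤⇒≤ᵇ; m≤n+m; m≤m⊔n; m≤n⊔m; ≤-trans; ≤-reflexive; n<1+n; *-monoʳ-≤; *-suc; ⊔-lub)
import Data.Fin as Fin
open import Data.Fin using (Fin; zero; suc; combine; remQuot)
open import Data.Fin.Properties using (remQuot-combine; any?; all?; ¬∀⟶∃¬; pigeonhole)
open import Data.Bool using (true; false; T)
open import Data.Bool.Properties using (¬-not) renaming (_≟_ to _≟ᵇ_)
open import Data.Product using (_,_; proj₁; proj₂)
open import Data.Empty using (⊥; ⊥-elim)
open import Relation.Nullary using (Dec; yes; no)
open import Relation.Binary.PropositionalEquality

AtMostOneTrue : ∀ {m} → (Fin m → Bool) → Set
AtMostOneTrue b = ∀ {l l'} → l Fin.< l' → b l ≡ true → b l' ≡ true → ⊥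

countTrue-≥1 : ∀ {m} (b : Fin m → Bool) l → b l ≡ true → 1 ≤ countTrue b
countTrue-≥1 b zero bl rewrite bl = s≤s z≤n
countTrue-≥1 b (suc l) bl = ≤-trans (countTrue-≥1 (λ i → b (suc i)) l bl) (m≤n+m _ _)

countTrue-≥2 : ∀ {m} (b : Fin m → Bool) {l l'} → l Fin.< l' →
               b l ≡ true → b l' ≡ true → 2 ≤ countTrue b
countTrue-≥2 b {zero} {suc l'} _ bl bl' rewrite bl = s≤s (countTrue-≥1 (λ i → b (suc i)) l' bl')
countTrue-≥2 b {suc l} {suc l'} (s≤s l<l') bl bl' =
  ≤-trans (countTrue-≥2 (λ i → b (suc i)) l<l' bl bl') (m≤n+m _ _)

THR2-false⇒atMostOne : ∀ k (b : Fin (suc k) → Bool) → THR2 k b ≡ false → AtMostOneTrue b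
THR2-false⇒atMostOne k b thr≡false l<l' bl bl' =
  subst T thr≡false (≤⇒≤ᵇ (countTrue-≥2 b l<l' bl bl'))

ZeroColumn : ∀ {k m} → (Fin k → Fin m → Bool) → Fin m → Set
ZeroColumn B l = ∀ j → B j l ≡ false

zeroColumn? : ∀ {k m} (B : Fin k → Fin m → Bool) → Dec (∃ (ZeroColumn B))
zeroColumn? B = any? (λ l → all? (λ j → B j l ≟ᵇ false))

-- Otherwise every column would
-- have a row with a 1 there, and two columns would share that row.
commonZeroColumn : ∀ {k m} → k < m → (B : Fin k → Fin m → Bool) →
                   (∀ j → AtMostOneTrue (B j)) → ∃ (ZeroColumn B)
commonZeroColumn {k} k<m B rowsSparse with zeroColumn? B
... | yes zeroCol = zeroCol
... | no noZeroCol = ⊥-elim collision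
  where
  oneInColumn : ∀ l → ∃ λ j → B j l ≡ true
  oneInColumn l with ¬∀⟶∃¬ k (λ j → B j l ≡ false) (λ j → B j l ≟ᵇ false)
                              (λ zero-l → noZeroCol (l , zero-l))
  ... | j , Bjl≢false = j , ¬-not Bjl≢false

  collision : ⊥
  collision with pigeonhole k<m (λ l → proj₁ (oneInColumn l))
  ... | l , l' , l<l' , sameRow =
    rowsSparse (proj₁ (oneInColumn l)) l<l' (proj₂ (oneInColumn l))
      (subst (λ j → B j l' ≡ true) (sym sameRow) (proj₂ (oneInColumn l')))

pickColumn : ∀ {k m} → (Fin k → Fin (suc m) → Bool) → Fin (suc m)
pickColumn B with zeroColumn? B
... | yes (l , _) = l
... | no _ = zero

pickColumn-zero : ∀ {k m} (B : Fin k → Fin (suc m) → Bool) →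
                  ∃ (ZeroColumn B) → ZeroColumn B (pickColumn B)
pickColumn-zero B zeroCol with zeroColumn? B
... | yes (_ , isZero) = isZero
... | no noZeroCol = ⊥-elim (noZeroCol zeroCol)

module Broadcast {k n : ℕ} where

  Query : Set
  Query = Fin k × (Input n → Bool)

  answer : Query → (Fin k → Input n) → Bool
  answer (p , question) xs = question (xs p)

  cons : ∀ {L} → Bool → (Fin L → Bool) → Fin (suc L) → Bool
  cons b a zero = b
  cons b a (suc i) = a i

  broadcast : (L : ℕ) → (Fin L → Query) → ((Fin L → Bool) → Protocol k n) → Protocol k n
  broadcast zero q κ = κ (λ ())
  broadcast (suc L) q κ =
    node (proj₁ (q zero)) (proj₂ (q zero))
      (broadcast L (λ i → q (suc i)) (λ a → κ (cons false a)))
      (broadcast L (λ i → q (suc i)) (λ a → κ (cons true a)))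

  run-broadcast : ∀ L q κ (xs : Fin k → Input n) →
    ∃ λ (a : Fin L → Bool) → (∀ i → a i ≡ answer (q i) xs) ×
      run (broadcast L q κ) xs ≡ run (κ a) xs
  run-broadcast zero q κ xs = (λ ()) , (λ ()) , refl
  run-broadcast (suc L) q κ xs =
    let b = answer (q zero) xs
        (a , correct , runs) = run-broadcast L (λ i → q (suc i)) (λ a → κ (cons b a)) xs
    in cons b a , (λ { zero → refl ; (suc i) → correct i }) , trans (firstStep b refl) runs
    where
    firstStep : ∀ b → answer (q zero) xs ≡ b →
      run (broadcast (suc L) q κ) xs ≡ run (broadcast L (λ i → q (suc i)) (λ a → κ (cons b a))) xs
    firstStep false firstBit rewrite firstBit = refl
    firstStep true firstBit rewrite firstBit = refl

  depth-broadcast : ∀ L q κ D → (∀ a → depthP (κ a) ≤ D) → depthP (broadcast L q κ) ≤ L + D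
  depth-broadcast zero q κ D bound = bound _
  depth-broadcast (suc L) q κ D bound =
    s≤s (⊔-lub (depth-broadcast L _ _ D (λ _ → bound _))
               (depth-broadcast L _ _ D (λ _ → bound _)))

open Broadcast

maxFin-≥ : ∀ {m} (d : Fin m → ℕ) l → d l ≤ maxFin d
maxFin-≥ d zero = m≤m⊔n _ _
maxFin-≥ d (suc l) = ≤-trans (maxFin-≥ (λ i → d (suc i)) l) (m≤n⊔m _ _)

module Simulation {k n : ℕ} where

  -- bits broadcast at a gate: one per (party, child) pair
  gateBits : ℕ
  gateBits = k * suc k

  -- bit (combine j l) is party j's value of the l-th child
  gateQuery : ∀ {m} → Nodes k n m → (Fin (suc k) → Fin m) → Fin gateBits → Query
  gateQuery ns ch idx =
    let (j , l) = remQuot {k} (suc k) idx in j , λ x → nodeVal ns x (ch l)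

  asMatrix : (Fin gateBits → Bool) → Fin k → Fin (suc k) → Bool
  asMatrix a j l = a (combine j l)

  simulate : ∀ {m} → Nodes k n m → Fin m → Protocol k n
  simulate (ns ▹ var i) zero = leaf i
  simulate (ns ▹ thr ch) zero =
    broadcast gateBits (gateQuery ns ch) (λ a → simulate ns (ch (pickColumn (asMatrix a))))
  simulate (ns ▹ _) (suc v) = simulate ns v

  simulate-correct : ∀ {m} (ns : Nodes k n m) v (xs : Fin k → Input n) →
    (∀ j → nodeVal ns (xs j) v ≡ false) → ∀ j → xs j (run (simulate ns v) xs) ≡ false
  simulate-correct (ns ▹ var i) zero xs nodeZero = nodeZero
  simulate-correct (ns ▹ thr ch) zero xs gateZero
    with run-broadcast gateBits (gateQuery ns ch)
           (λ a → simulate ns (ch (pickColumn (asMatrix a)))) xs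
  ... | a , correct , runs rewrite runs =
    simulate-correct ns (ch (pickColumn A)) xs childZero
    where
    A : Fin k → Fin (suc k) → Bool
    A = asMatrix a
    A-values : ∀ j l → A j l ≡ nodeVal ns (xs j) (ch l)
    A-values j l = trans (correct (combine j l))
      (cong (λ jl → nodeVal ns (xs (proj₁ jl)) (ch (proj₂ jl))) (remQuot-combine {k} {suc k} j l))
    rowsSparse : ∀ j → AtMostOneTrue (A j)
    rowsSparse j l<l' Ajl Ajl' =
      THR2-false⇒atMostOne k (λ l → nodeVal ns (xs j) (ch l)) (gateZero j) l<l'
        (trans (sym (A-values j _)) Ajl) (trans (sym (A-values j _)) Ajl')
    childZero : ∀ j → nodeVal ns (xs j) (ch (pickColumn A)) ≡ false
    childZero j = trans (sym (A-values j _))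
      (pickColumn-zero A (commonZeroColumn (n<1+n k) A rowsSparse) j)
  simulate-correct (ns ▹ var _) (suc v) = simulate-correct ns v
  simulate-correct (ns ▹ thr _) (suc v) = simulate-correct ns v

  simulate-depth : ∀ {m} (ns : Nodes k n m) v → depthP (simulate ns v) ≤ gateBits * nodeDepth ns v
  simulate-depth (ns ▹ var i) zero = z≤n
  simulate-depth (ns ▹ thr ch) zero =
    ≤-trans (depth-broadcast gateBits (gateQuery ns ch) _ (gateBits * maxChild)
               (λ _ → ≤-trans (simulate-depth ns _) (*-monoʳ-≤ gateBits (maxFin-≥ childDepth _))))
            (≤-reflexive (sym (*-suc gateBits maxChild)))
    where
    childDepth : Fin (suc k) → ℕ
    childDepth l = nodeDepth ns (ch l)
    maxChild : ℕ
    maxChild = maxFin childDepth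
  simulate-depth (ns ▹ var _) (suc v) = simulate-depth ns v
  simulate-depth (ns ▹ thr _) (suc v) = simulate-depth ns v

open Simulation

proposition7 : (k : ℕ) → 2 ≤ k → ∃ λ (c : ℕ) →
    ∀ (n : ℕ) (f : Input n → Bool) → InQ k f →
    (C : Circuit k n) → C ≤C f →
    ∃ λ (π : Protocol k n) → ComputesGame π f × depthP π ≤ c * depthC C
proposition7 k _ = k * suc k , λ where
  n f _ (circuit _ ns out) C≤f →
    simulate ns out
    , (λ xs inputsZero → simulate-correct ns out xs (λ j → C≤f (xs j) (inputsZero j)))
    , simulate-depth ns out
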